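{- Let $G$ be a finite group. Then $\alpha(\Gamma_G)=2$ if and only if $G\cong\mathbb{Z}_{pq^n}$ for some distinct primes $p$ and $q$ and some positive integer $n$.
   Context: The (undirected) power graph $\Gamma_G$ of a finite group $G$ has vertex set $G$, two distinct elements being adjacent if one is a power of the other. $\alpha(\Gamma)$ denotes the independence number of a graph $\Gamma$. $\mathbb{Z}_m$ denotes the cyclic group of order $m$. -}

module Defs where

open import Data.Nat using (ℕ; zero; suc; _+_; _*_; _^_; _≤_)
open import Data.Nat.DivMod using (_mod_)
open import Data.Nat.Primality using (Prime)
open import Data.Fin using (Fin; toℕ)
open import Data.Fin.Subset using (Subset; _∈_; ∣_∣)
open import Data.Product using (Σ; ∃; _×_; _,_)
open import Data.Sum using (_⊎_)
open import Relation.Binary.PropositionalEquality using (_≡_; _≢_)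
open import Relation.Nullary using (¬_)
open import Function.Definitions using (Bijective)

-- A finite group, presented on the carrier Fin order (every finite group
-- is isomorphic to one of this form).
record FiniteGroup : Set where
  infixl 7 _∙_
  field
    order    : ℕ
    _∙_      : Fin order → Fin order → Fin order
    e        : Fin order
    inv      : Fin order → Fin order
    assoc    : ∀ x y z → (x ∙ y) ∙ z ≡ x ∙ (y ∙ z)
    identityˡ : ∀ x → e ∙ x ≡ x
    identityʳ : ∀ x → x ∙ e ≡ x
    inverseˡ : ∀ x → inv x ∙ x ≡ e
    inverseʳ : ∀ x → x ∙ inv x ≡ e

  Elt : Set
  Elt = Fin order

  pow : Elt → ℕ → Elt
  pow x zero    = e
  pow x (suc k) = x ∙ pow x k

  -- y is a power of x (in a finite group, integer powers = natural powers)
  IsPowerOf : Elt → Elt → Set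
  IsPowerOf y x = ∃ λ k → pow x k ≡ y

  Adjacent : Elt → Elt → Set
  Adjacent x y = x ≢ y × (IsPowerOf y x ⊎ IsPowerOf x y)

  Independent : Subset order → Set
  Independent S = ∀ x y → x ∈ S → y ∈ S → ¬ Adjacent x y

  IndependenceNumber≡ : ℕ → Set
  IndependenceNumber≡ k =
    (∃ λ S → Independent S × ∣ S ∣ ≡ k) × (∀ S → Independent S → ∣ S ∣ ≤ k)

_+ₘ_ : ∀ {m} → Fin m → Fin m → Fin m
_+ₘ_ {suc m} a b = (toℕ a + toℕ b) mod (suc m)

IsoToCyclic : FiniteGroup → ℕ → Set
IsoToCyclic G m = Σ (Elt → Fin m) λ f →
    Bijective _≡_ _≡_ f × (∀ x y → f (x ∙ y) ≡ f x +ₘ f y)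
  where open FiniteGroup G

-- Order G by "x is a power of y"; an independent set of Γ_G is then an antichain of this
-- preorder, so α(Γ_G) = 2 says that the widest antichain has exactly two elements.
-- If G is not cyclic, pick a maximal element a and a maximal b that is not a power of a:
-- then a, b and ab are pairwise incomparable, so α(Γ_G) ≤ 2 forces G to be cyclic.
-- In ℤ_m, y is a power of x iff gcd(x, m) divides gcd(y, m), and every divisor of m
-- occurs as such a gcd, so the power preorder of ℤ_m is the divisor lattice of m turned
-- upside down. The divisors of m contain a 2-antichain but no 3-antichain iff m = p qⁿ:
-- m cannot be a prime power, three primes or p², qp, q² would form a 3-antichain, and
-- the divisors of p qⁿ are covered by the two chains qⁱ and p qⁱ.
module Submission where

open import Defs
open import Data.Nat using (ℕ; _*_; _^_; _≤_)
open import Data.Nat.Primality using (Prime)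
open import Data.Product using (∃; _×_)
open import Relation.Binary.PropositionalEquality using (_≢_)
open import Function.Bundles using (_⇔_)

open import Algebra.Bundles using (Group)
import Algebra.Properties.Group as GroupProperties
open import Data.Bool.Base using (true; false)
open import Data.Empty using (⊥-elim)
open import Data.Fin.Base using (Fin; toℕ)
open import Data.Fin.Properties
  using (any?; all?; ¬∀⟶∃¬; pigeonhole; nonZeroIndex; toℕ<n; toℕ-fromℕ<; toℕ-injective)
  renaming (_≟_ to _≟ᶠ_)
open import Data.Fin.Subset using (Subset; _∈_; _∉_; _⊆_; ∣_∣; ⁅_⁆; _∪_) renaming (⊥ to ∅)
open import Data.Fin.Subset.Properties
  using (_∈?_; ∣p∣≤n; ∣⊥∣≡0; ∣⁅x⁆∣≡1; p⊆q⇒∣p∣≤∣q∣; p⊂q⇒∣p∣<∣q∣; q⊆p∪q; x∈p∪q⁺; x∈p∪q⁻;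
         x∈⁅x⁆; x∈⁅y⁆⇒x≡y; x≢y⇒x∉⁅y⁆)
open import Data.List.Base using ([]; _∷_; length)
open import Data.List.Relation.Unary.All using (All; []; _∷_)
open import Data.Nat.Base
open import Data.Nat.Coprimality using (Coprime; coprime-divisor)
import Data.Nat.Coprimality as Coprime
open import Data.Nat.Divisibility
open import Data.Nat.DivMod
  using (_mod_; _/_; m%n<n; m≡m%n+[m/n]*n; %-distribˡ-+; %-distribˡ-*; m%n%n≡m%n; [m+kn]%n≡m%n;
         m<n⇒m%n≡m; m*n%n≡0)
open import Data.Nat.GCD using (gcd; gcd-GCD; gcd[m,n]∣m; gcd[m,n]∣n; gcd-greatest; module Bézout)
open import Data.Nat.Induction using (<-wellFounded)
open import Data.Nat.ListAction using (product)
open import Data.Nat.Primality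
  using (prime?; prime⇒nonZero; prime⇒nonTrivial; prime⇒irreducible; euclidsLemma)
open import Data.Nat.Primality.Factorisation using (factorise)
open import Data.Nat.Properties
open import Data.Nat.Tactic.RingSolver using (solve-∀)
open import Data.Product using (∃₂; _,_; proj₁; proj₂)
open import Data.Sum using (_⊎_; inj₁; inj₂)
open import Data.Unit.Base using (tt)
open import Data.Vec.Base using ([]; _∷_; tabulate)
open import Data.Vec.Properties using (lookup∘tabulate; lookup⇒[]=; []=⇒lookup)
open import Function.Bundles using (mk⇔; Equivalence)
open import Induction.WellFounded using (Acc; acc)
open import Level using (0ℓ)
open import Relation.Binary.Definitions using (tri<; tri≈; tri>)
open import Relation.Binary.PropositionalEquality
  using (_≡_; refl; sym; trans; cong; cong₂; subst; subst₂; ≢-sym; isEquivalence; module ≡-Reasoning)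
open import Relation.Nullary using (¬_; Dec; yes; no; does; _×-dec_; ¬?; contradiction)
open import Relation.Nullary.Decidable using (decidable-stable; dec-true)
open import Relation.Unary using (U)

-- Antichains and maximal elements of preorders

Incomparable : {A : Set} → (A → A → Set) → A → A → Set
Incomparable _≼_ x y = ¬ x ≼ y × ¬ y ≼ x

Incomparable₃ : {A : Set} → (A → A → Set) → A → A → A → Set
Incomparable₃ _≼_ x y z = Incomparable _≼_ x y × Incomparable _≼_ x z × Incomparable _≼_ y z

Chain : {A : Set} → (A → A → Set) → (A → Set) → Set
Chain _≼_ P = ∀ {x y} → P x → P y → ¬ Incomparable _≼_ x y

Antichain₂ : {A : Set} → (A → A → Set) → (A → Set) → Set
Antichain₂ _≼_ P = ∃₂ λ x y → P x × P y × Incomparable _≼_ x y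

Antichain₃ : {A : Set} → (A → A → Set) → (A → Set) → Set
Antichain₃ _≼_ P = ∃ λ x → ∃₂ λ y z → P x × P y × P z × Incomparable₃ _≼_ x y z

Maximal : {A : Set} → (A → A → Set) → A → Set
Maximal _≼_ a = ∀ {z} → a ≼ z → z ≼ a

module _ {A : Set} {_≼_ : A → A → Set} where

  Incomparable-sym : ∀ {x y} → Incomparable _≼_ x y → Incomparable _≼_ y x
  Incomparable-sym (x⋠y , y⋠x) = y⋠x , x⋠y

  maximal-Incomparable : ∀ {a b} → Maximal _≼_ a → ¬ b ≼ a → Incomparable _≼_ a b
  maximal-Incomparable a-max b⋠a = (λ a≼b → b⋠a (a-max a≼b)) , b⋠a

  chain⇒¬Antichain₂ : ∀ {P} → Chain _≼_ P → ¬ Antichain₂ _≼_ P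
  chain⇒¬Antichain₂ chain (_ , _ , Px , Py , x∥y) = chain Px Py x∥y

  two-chains⇒¬Antichain₃ : ∀ {P Q R} → Chain _≼_ Q → Chain _≼_ R →
                          (∀ {x} → P x → Q x ⊎ R x) → ¬ Antichain₃ _≼_ P
  two-chains⇒¬Antichain₃ Q-chain R-chain split (_ , _ , _ , Px , Py , Pz , x∥y , x∥z , y∥z)
    with split Px | split Py | split Pz
  ... | inj₁ Qx | inj₁ Qy | _       = Q-chain Qx Qy x∥y
  ... | inj₁ Qx | inj₂ _  | inj₁ Qz = Q-chain Qx Qz x∥z
  ... | inj₁ _  | inj₂ Ry | inj₂ Rz = R-chain Ry Rz y∥z
  ... | inj₂ _  | inj₁ Qy | inj₁ Qz = Q-chain Qy Qz y∥z
  ... | inj₂ Rx | inj₁ _  | inj₂ Rz = R-chain Rx Rz x∥z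
  ... | inj₂ Rx | inj₂ Ry | _       = R-chain Rx Ry x∥y

module _ {n : ℕ} {_≼_ : Fin n → Fin n → Set}
         (≼-refl : ∀ {x} → x ≼ x) (≼-trans : ∀ {x y z} → x ≼ y → y ≼ z → x ≼ z)
         (_≼?_ : ∀ x y → Dec (x ≼ y)) where

  private
    downset : Fin n → Subset n
    downset y = tabulate (λ w → does (w ≼? y))

    ∈-downset⁺ : ∀ {w y} → w ≼ y → w ∈ downset y
    ∈-downset⁺ {w} {y} w≼y =
      lookup⇒[]= w (downset y) (trans (lookup∘tabulate _ w) (dec-true (w ≼? y) w≼y))

    ∈-downset⁻ : ∀ {w y} → w ∈ downset y → w ≼ y
    ∈-downset⁻ {w} {y} w∈
      with w ≼? y | trans (sym (lookup∘tabulate (λ v → does (v ≼? y)) w)) ([]=⇒lookup w∈)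
    ... | yes w≼y | _  = w≼y
    ... | no _    | ()

    downset-< : ∀ {y z} → y ≼ z → ¬ z ≼ y → ∣ downset y ∣ < ∣ downset z ∣
    downset-< y≼z z⋠y = p⊂q⇒∣p∣<∣q∣
      ( (λ w∈ → ∈-downset⁺ (≼-trans (∈-downset⁻ w∈) y≼z))
      , _ , ∈-downset⁺ ≼-refl , λ z∈ → z⋠y (∈-downset⁻ z∈))

    climb : ∀ y → Acc _<_ (n ∸ ∣ downset y ∣) → ∃ λ a → y ≼ a × Maximal _≼_ a
    climb y (acc rec) with any? (λ z → (y ≼? z) ×-dec ¬? (z ≼? y))
    ... | yes (z , y≼z , z⋠y) =
      let (a , z≼a , a-max) = climb z (rec (∸-monoʳ-< (downset-< y≼z z⋠y) (∣p∣≤n (downset z))))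
      in a , ≼-trans y≼z z≼a , a-max
    ... | no none = y , ≼-refl , λ {z} y≼z → decidable-stable (z ≼? y) (λ z⋠y → none (z , y≼z , z⋠y))

  below-maximal : ∀ y → ∃ λ a → y ≼ a × Maximal _≼_ a
  below-maximal y = climb y (<-wellFounded _)

-- Divisors of natural numbers

prime≢1 : ∀ {p} → Prime p → p ≢ 1
prime≢1 pp = nonTrivial⇒≢1 {{prime⇒nonTrivial pp}}

prime∣prime⇒≡ : ∀ {p q} → Prime p → Prime q → p ∣ q → p ≡ q
prime∣prime⇒≡ pp pq p∣q with prime⇒irreducible pq p∣q
... | inj₁ p≡1 = ⊥-elim (prime≢1 pp p≡1)
... | inj₂ p≡q = p≡q

prime-Incomparable : ∀ {p q} → Prime p → Prime q → p ≢ q → Incomparable _∣_ p q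
prime-Incomparable pp pq p≢q =
  (λ p∣q → p≢q (prime∣prime⇒≡ pp pq p∣q)) , (λ q∣p → p≢q (sym (prime∣prime⇒≡ pq pp q∣p)))

prime∤⇒coprime : ∀ {p m} → Prime p → ¬ p ∣ m → Coprime p m
prime∤⇒coprime pp p∤m (d∣p , d∣m) with prime⇒irreducible pp d∣p
... | inj₁ d≡1  = d≡1
... | inj₂ refl = ⊥-elim (p∤m d∣m)

prime∣*prime⇒∣ : ∀ {q p r} → Prime q → Prime p → q ≢ p → q ∣ r * p → q ∣ r
prime∣*prime⇒∣ {r = r} pq pp q≢p q∣rp with euclidsLemma r _ pq q∣rp
... | inj₁ q∣r = q∣r
... | inj₂ q∣p = ⊥-elim (q≢p (prime∣prime⇒≡ pq pp q∣p))

prime∣square⇒∣ : ∀ {p q} → Prime p → p ∣ q * q → p ∣ q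
prime∣square⇒∣ {q = q} pp p∣q² with euclidsLemma q q pp p∣q²
... | inj₁ p∣q = p∣q
... | inj₂ p∣q = p∣q

prime∣^⇒∣ : ∀ {p m} n → Prime p → p ∣ m ^ n → p ∣ m
prime∣^⇒∣ zero    pp p∣1 = ⊥-elim (prime≢1 pp (∣1⇒≡1 p∣1))
prime∣^⇒∣ {m = m} (suc n) pp p∣m*mⁿ with euclidsLemma m (m ^ n) pp p∣m*mⁿ
... | inj₁ p∣m  = p∣m
... | inj₂ p∣mⁿ = prime∣^⇒∣ n pp p∣mⁿ

prime∣p^n⇒1≤n : ∀ {p} n → Prime p → p ∣ p ^ n → 1 ≤ n
prime∣p^n⇒1≤n zero    pp p∣1 = ⊥-elim (prime≢1 pp (∣1⇒≡1 p∣1))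
prime∣p^n⇒1≤n (suc n) _  _   = s≤s z≤n

∣p^n⇒≡p^k : ∀ {p d} n → Prime p → d ∣ p ^ n → ∃ λ k → d ≡ p ^ k
∣p^n⇒≡p^k zero pp d∣1 = 0 , ∣1⇒≡1 d∣1
∣p^n⇒≡p^k {p} {d} (suc n) pp d∣pⁿ⁺¹ with p ∣? d
... | yes (divides e refl) =
  let instance _ = prime⇒nonZero pp
      (k , e≡pᵏ) = ∣p^n⇒≡p^k n pp (*-cancelˡ-∣ p (subst (_∣ p ^ suc n) (*-comm e p) d∣pⁿ⁺¹))
  in suc k , trans (*-comm e p) (cong (p *_) e≡pᵏ)
... | no p∤d = ∣p^n⇒≡p^k n pp (coprime-divisor (Coprime.sym (prime∤⇒coprime pp p∤d)) d∣pⁿ⁺¹)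

^-monoʳ-∣ : ∀ m {i j} → i ≤ j → m ^ i ∣ m ^ j
^-monoʳ-∣ m {i} {j} i≤j = divides (m ^ (j ∸ i)) (begin
  m ^ j               ≡⟨ cong (m ^_) (m+[n∸m]≡n i≤j) ⟨
  m ^ (i + (j ∸ i))   ≡⟨ ^-distribˡ-+-* m i (j ∸ i) ⟩
  m ^ i * m ^ (j ∸ i) ≡⟨ *-comm (m ^ i) _ ⟩
  m ^ (j ∸ i) * m ^ i ∎)
  where open ≡-Reasoning

prime-power-divisors-chain : ∀ {p} n → Prime p → Chain _∣_ (_∣ p ^ n)
prime-power-divisors-chain {p} n pp d∣pⁿ d'∣pⁿ (d∤d' , d'∤d)
  with ∣p^n⇒≡p^k n pp d∣pⁿ | ∣p^n⇒≡p^k n pp d'∣pⁿ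
... | i , refl | j , refl with ≤-total i j
...   | inj₁ i≤j = d∤d' (^-monoʳ-∣ p i≤j)
...   | inj₂ j≤i = d'∤d (^-monoʳ-∣ p j≤i)

*-chain : ∀ {P} p → Chain _∣_ P → Chain _∣_ (λ d → ∃ λ e → d ≡ e * p × P e)
*-chain p chain (e , refl , Pe) (e' , refl , Pe') (ep∤e'p , e'p∤ep) =
  chain Pe Pe' ((λ e∣e' → ep∤e'p (*-monoˡ-∣ p e∣e')) , (λ e'∣e → e'p∤ep (*-monoˡ-∣ p e'∣e)))

Incomparable-*ˡ : ∀ {a b} c .{{_ : NonZero c}} → Incomparable _∣_ a b → Incomparable _∣_ (c * a) (c * b)
Incomparable-*ˡ c (a∤b , b∤a) =
  (λ ca∣cb → a∤b (*-cancelˡ-∣ c ca∣cb)) , (λ cb∣ca → b∤a (*-cancelˡ-∣ c cb∣ca))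

Incomparable-*ʳ : ∀ {a b} c .{{_ : NonZero c}} → Incomparable _∣_ a b → Incomparable _∣_ (a * c) (b * c)
Incomparable-*ʳ c (a∤b , b∤a) =
  (λ ac∣bc → a∤b (*-cancelʳ-∣ c ac∣bc)) , (λ bc∣ac → b∤a (*-cancelʳ-∣ c bc∣ac))

divisor-of-p*m : ∀ {p m d} → Prime p → d ∣ p * m → (∃ λ e → d ≡ e * p × e ∣ m) ⊎ d ∣ m
divisor-of-p*m {p} {m} {d} pp d∣pm with p ∣? d
... | yes (divides e refl) =
  let instance _ = prime⇒nonZero pp
  in inj₁ (e , refl , *-cancelˡ-∣ p (subst (_∣ p * m) (*-comm e p) d∣pm))
... | no p∤d = inj₂ (coprime-divisor (Coprime.sym (prime∤⇒coprime pp p∤d)) d∣pm)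

prime-divisor : ∀ m .{{_ : NonZero m}} → m ≢ 1 → ∃ λ p → Prime p × p ∣ m
prime-divisor m m≢1 with factorise m
... | record { factors = [] ; isFactorisation = m≡1 } = ⊥-elim (m≢1 m≡1)
... | record { factors = p ∷ ps ; isFactorisation = m≡p*∏ps ; factorsPrime = pp ∷ _ } =
  p , pp , divides (product ps) (trans m≡p*∏ps (*-comm p _))

unique-prime-divisor⇒prime-power : ∀ {q} m .{{_ : NonZero m}} →
  (∀ {s} → Prime s → s ∣ m → s ≡ q) → ∃ λ n → m ≡ q ^ n
unique-prime-divisor⇒prime-power {q} m only-q with factorise m
... | record { factors = ps ; isFactorisation = m≡∏ps ; factorsPrime = pps } =
  length ps , trans m≡∏ps (∏≡q^length ps pps (λ ps s∣ → only-q ps (subst (_ ∣_) (sym m≡∏ps) s∣)))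
  where
  ∏≡q^length : ∀ ps → All Prime ps → (∀ {s} → Prime s → s ∣ product ps → s ≡ q) → product ps ≡ q ^ length ps
  ∏≡q^length []       _          _      = refl
  ∏≡q^length (p ∷ ps) (pp ∷ pps) only-q =
    cong₂ _*_ (only-q pp (m∣m*n (product ps))) (∏≡q^length ps pps (λ ps s∣ → only-q ps (∣n⇒∣m*n p s∣)))

-- Numbers whose divisors form a poset of width two

IsPQⁿ : ℕ → Set
IsPQⁿ m = ∃ λ p → ∃ λ q → ∃ λ n → Prime p × Prime q × p ≢ q × 1 ≤ n × m ≡ p * q ^ n

p*q^n-Antichain₂ : ∀ {p q n} → Prime p → Prime q → p ≢ q → 1 ≤ n → Antichain₂ _∣_ (_∣ p * q ^ n)
p*q^n-Antichain₂ {p} {q} {suc n} pp pq p≢q _ =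
  p , q ^ suc n , m∣m*n (q ^ suc n) , n∣m*n p ,
  (λ p∣qⁿ⁺¹ → p≢q (prime∣prime⇒≡ pp pq (prime∣^⇒∣ (suc n) pp p∣qⁿ⁺¹))) ,
  (λ qⁿ⁺¹∣p → p≢q (sym (prime∣prime⇒≡ pq pp (∣-trans (m∣m*n (q ^ n)) qⁿ⁺¹∣p))))

p*q^n-¬Antichain₃ : ∀ {p q} n → Prime p → Prime q → ¬ Antichain₃ _∣_ (_∣ p * q ^ n)
p*q^n-¬Antichain₃ {p} n pp pq = two-chains⇒¬Antichain₃
  (*-chain p (prime-power-divisors-chain n pq)) (prime-power-divisors-chain n pq) (divisor-of-p*m pp)

Antichain₂-divisors⇒≢1 : ∀ {m} → Antichain₂ _∣_ (_∣ m) → m ≢ 1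
Antichain₂-divisors⇒≢1 (_ , _ , d∣1 , d'∣1 , d∤d' , _) refl =
  d∤d' (subst₂ _∣_ (sym (∣1⇒≡1 d∣1)) (sym (∣1⇒≡1 d'∣1)) ∣-refl)

second-prime-divisor : ∀ {p} m .{{_ : NonZero m}} → Prime p → Antichain₂ _∣_ (_∣ m) →
                       ∃ λ q → Prime q × q ∣ m × q ≢ p
second-prime-divisor {p} m pp antichain
  with anyUpTo? (λ s → prime? s ×-dec (s ∣? m ×-dec ¬? (s ≟ p))) (suc m)
... | yes (q , _ , q-found) = q , q-found
... | no none =
  let (k , m≡pᵏ) = unique-prime-divisor⇒prime-power m only-p
  in ⊥-elim (chain⇒¬Antichain₂ (prime-power-divisors-chain k pp)
               (subst (λ n → Antichain₂ _∣_ (_∣ n)) m≡pᵏ antichain))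
  where
  only-p : ∀ {s} → Prime s → s ∣ m → s ≡ p
  only-p {s} ps s∣m with s ≟ p
  ... | yes s≡p = s≡p
  ... | no s≢p  = ⊥-elim (none (s , s≤s (∣⇒≤ s∣m) , ps , s∣m , s≢p))

at-most-two-prime-divisors : ∀ {p q m} → Prime p → Prime q → p ≢ q → p ∣ m → q ∣ m →
  ¬ Antichain₃ _∣_ (_∣ m) → ∀ {s} → Prime s → s ∣ m → s ≡ p ⊎ s ≡ q
at-most-two-prime-divisors {p} {q} pp pq p≢q p∣m q∣m no-antichain {s} ps s∣m with s ≟ p | s ≟ q
... | yes s≡p | _       = inj₁ s≡p
... | no _    | yes s≡q = inj₂ s≡q
... | no s≢p  | no s≢q  = ⊥-elim (no-antichain (p , q , s , p∣m , q∣m , s∣m ,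
  prime-Incomparable pp pq p≢q , prime-Incomparable pp ps (≢-sym s≢p) ,
  prime-Incomparable pq ps (≢-sym s≢q)))

squares-Incomparable₃ : ∀ {p q} → Prime p → Prime q → p ≢ q → Incomparable₃ _∣_ (p * p) (q * p) (q * q)
squares-Incomparable₃ {p} {q} pp pq p≢q =
  Incomparable-*ʳ p p∥q ,
  ((λ p²∣q² → proj₁ p∥q (prime∣square⇒∣ pp (∣-trans (m∣m*n p) p²∣q²))) ,
   (λ q²∣p² → proj₂ p∥q (prime∣square⇒∣ pq (∣-trans (m∣m*n q) q²∣p²)))) ,
  Incomparable-*ˡ q p∥q
  where
  instance _ = prime⇒nonZero pp
  instance _ = prime⇒nonZero pq
  p∥q : Incomparable _∣_ p q
  p∥q = prime-Incomparable pp pq p≢q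

distinct-prime-divisors⇒*∣ : ∀ {p q m} → Prime p → Prime q → p ≢ q → p ∣ m → q ∣ m → q * p ∣ m
distinct-prime-divisors⇒*∣ {p} pp pq p≢q (divides r refl) q∣rp =
  *-monoˡ-∣ p (prime∣*prime⇒∣ {r = r} pq pp (≢-sym p≢q) q∣rp)

p²∤⇒IsPQⁿ : ∀ {p q m} .{{_ : NonZero m}} → Prime p → Prime q → p ≢ q →
  p ∣ m → q ∣ m → ¬ p * p ∣ m → (∀ {s} → Prime s → s ∣ m → s ≡ p ⊎ s ≡ q) → IsPQⁿ m
p²∤⇒IsPQⁿ {p} {q} {m} pp pq p≢q (divides r m≡rp) q∣m p²∤m p-or-q =
  let (n , r≡qⁿ) = unique-prime-divisor⇒prime-power r only-q
  in p , q , n , pp , pq , p≢q , prime∣p^n⇒1≤n n pq (subst (q ∣_) r≡qⁿ q∣r) ,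
     trans m≡rp (trans (*-comm r p) (cong (p *_) r≡qⁿ))
  where
  instance
    r-nonZero : NonZero r
    r-nonZero = ≢-nonZero λ { refl → ≢-nonZero⁻¹ m m≡rp }
  q∣r : q ∣ r
  q∣r = prime∣*prime⇒∣ pq pp (≢-sym p≢q) (subst (q ∣_) m≡rp q∣m)
  only-q : ∀ {s} → Prime s → s ∣ r → s ≡ q
  only-q ps s∣r with p-or-q ps (∣-trans s∣r (divides p (trans m≡rp (*-comm r p))))
  ... | inj₁ refl = ⊥-elim (p²∤m (subst (p * p ∣_) (sym m≡rp) (*-monoˡ-∣ p s∣r)))
  ... | inj₂ s≡q  = s≡q

divisor-width-2⇒IsPQⁿ : ∀ m .{{_ : NonZero m}} → Antichain₂ _∣_ (_∣ m) → ¬ Antichain₃ _∣_ (_∣ m) → IsPQⁿ m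
divisor-width-2⇒IsPQⁿ m antichain no-antichain with prime-divisor m (Antichain₂-divisors⇒≢1 antichain)
... | p , pp , p∣m with second-prime-divisor m pp antichain
...   | q , pq , q∣m , q≢p with p * p ∣? m | q * q ∣? m
...     | no p²∤m  | _        = p²∤⇒IsPQⁿ pp pq (≢-sym q≢p) p∣m q∣m p²∤m
                                  (at-most-two-prime-divisors pp pq (≢-sym q≢p) p∣m q∣m no-antichain)
...     | yes _    | no q²∤m  = p²∤⇒IsPQⁿ pq pp q≢p q∣m p∣m q²∤m
                                  (at-most-two-prime-divisors pq pp q≢p q∣m p∣m no-antichain)
...     | yes p²∣m | yes q²∣m = ⊥-elim (no-antichain (p * p , q * p , q * q , p²∣m ,
                                  distinct-prime-divisors⇒*∣ pp pq (≢-sym q≢p) p∣m q∣m , q²∣m ,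
                                  squares-Incomparable₃ pp pq (≢-sym q≢p)))

-- Modular arithmetic

least-witness : ∀ {P : ℕ → Set} → (∀ n → Dec (P n)) → ∀ {n} → P n → ∃ λ m → P m × (∀ {k} → k < m → ¬ P k)
least-witness {P} P? Pn = go _ (<-wellFounded _) Pn
  where
  go : ∀ n → Acc _<_ n → P n → ∃ λ m → P m × (∀ {k} → k < m → ¬ P k)
  go n (acc rec) Pn with anyUpTo? P? n
  ... | yes (k , k<n , Pk) = go k (rec k<n) Pk
  ... | no none            = n , Pn , λ k<n Pk → none (_ , k<n , Pk)

[m+[n%d]]%d≡[m+n]%d : ∀ m n d .{{_ : NonZero d}} → (m + n % d) % d ≡ (m + n) % d
[m+[n%d]]%d≡[m+n]%d m n d = begin
  (m + n % d) % d           ≡⟨ %-distribˡ-+ m (n % d) d ⟩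
  (m % d + n % d % d) % d   ≡⟨ cong (λ t → (m % d + t) % d) (m%n%n≡m%n n d) ⟩
  (m % d + n % d) % d       ≡⟨ %-distribˡ-+ m n d ⟨
  (m + n) % d               ∎
  where open ≡-Reasoning

[m*[n%d]]%d≡[m*n]%d : ∀ m n d .{{_ : NonZero d}} → (m * (n % d)) % d ≡ (m * n) % d
[m*[n%d]]%d≡[m*n]%d m n d = begin
  (m * (n % d)) % d         ≡⟨ %-distribˡ-* m (n % d) d ⟩
  (m % d * (n % d % d)) % d ≡⟨ cong (λ t → (m % d * t) % d) (m%n%n≡m%n n d) ⟩
  (m % d * (n % d)) % d     ≡⟨ %-distribˡ-* m n d ⟨
  (m * n) % d               ∎
  where open ≡-Reasoning

modular-Bézout : ∀ u m .{{_ : NonZero m}} → ∃ λ k → (k * u) % m ≡ gcd u m % m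
modular-Bézout u m@(suc m-1) with Bézout.identity (gcd-GCD u m)
... | Bézout.+- k l g+lm≡ku = k , trans (cong (_% m) (sym g+lm≡ku)) ([m+kn]%n≡m%n (gcd u m) l m)
-- Here k u ≡ - g (mod m), so multiplying by m - 1 ≡ - 1 gives g.
... | Bézout.-+ k l g+ku≡lm = m-1 * k , (begin
  (m-1 * k * u) % m            ≡⟨ [m+kn]%n≡m%n (m-1 * k * u) g m ⟨
  (m-1 * k * u + g * m) % m    ≡⟨ cong (_% m) (rearrange m-1 k u g) ⟩
  (m-1 * (g + k * u) + g) % m  ≡⟨ cong (λ t → (m-1 * t + g) % m) g+ku≡lm ⟩
  (m-1 * (l * m) + g) % m      ≡⟨ cong (λ t → (t + g) % m) (*-assoc m-1 l m) ⟨
  (m-1 * l * m + g) % m        ≡⟨ cong (_% m) (+-comm (m-1 * l * m) g) ⟩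
  (g + m-1 * l * m) % m        ≡⟨ [m+kn]%n≡m%n g (m-1 * l) m ⟩
  g % m                        ∎)
  where
  open ≡-Reasoning
  g = gcd u m
  rearrange : ∀ a k u g → a * k * u + g * suc a ≡ a * (g + k * u) + g
  rearrange = solve-∀

multiple-mod⇔gcd∣ : ∀ {u v m} .{{_ : NonZero m}} → v < m → (∃ λ k → (k * u) % m ≡ v) ⇔ gcd u m ∣ v
multiple-mod⇔gcd∣ {u} {v} {m} v<m = mk⇔
  (λ (k , ku%m≡v) → subst (gcd u m ∣_) ku%m≡v (%-presˡ-∣ (∣n⇒∣m*n k (gcd[m,n]∣m u m)) (gcd[m,n]∣n u m)))
  (λ { (divides c v≡cg) → let (k , ku%m≡g%m) = modular-Bézout u m in c * k , (begin
    (c * k * u) % m          ≡⟨ cong (_% m) (*-assoc c k u) ⟩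
    (c * (k * u)) % m        ≡⟨ [m*[n%d]]%d≡[m*n]%d c (k * u) m ⟨
    (c * ((k * u) % m)) % m  ≡⟨ cong (λ t → (c * t) % m) ku%m≡g%m ⟩
    (c * (gcd u m % m)) % m  ≡⟨ [m*[n%d]]%d≡[m*n]%d c (gcd u m) m ⟩
    (c * gcd u m) % m        ≡⟨ cong (_% m) (sym v≡cg) ⟩
    v % m                    ≡⟨ m<n⇒m%n≡m v<m ⟩
    v                        ∎) })
  where open ≡-Reasoning

gcd[d%m,m]≡d : ∀ {d m} .{{_ : NonZero m}} → d ∣ m → gcd (d % m) m ≡ d
gcd[d%m,m]≡d {d} {m} d∣m = ∣-antisym
  (∣n∣m%n⇒∣m (gcd[m,n]∣n (d % m) m) (gcd[m,n]∣m (d % m) m))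
  (gcd-greatest (%-presˡ-∣ ∣-refl d∣m) d∣m)

-- Finite subsets

∣p∪q∣≤∣p∣+∣q∣ : ∀ {n} (p q : Subset n) → ∣ p ∪ q ∣ ≤ ∣ p ∣ + ∣ q ∣
∣p∪q∣≤∣p∣+∣q∣ []          []          = z≤n
∣p∪q∣≤∣p∣+∣q∣ (true  ∷ p) (true  ∷ q) = s≤s (≤-trans (∣p∪q∣≤∣p∣+∣q∣ p q) (+-monoʳ-≤ ∣ p ∣ (n≤1+n ∣ q ∣)))
∣p∪q∣≤∣p∣+∣q∣ (true  ∷ p) (false ∷ q) = s≤s (∣p∪q∣≤∣p∣+∣q∣ p q)
∣p∪q∣≤∣p∣+∣q∣ (false ∷ p) (true  ∷ q) =
  ≤-trans (s≤s (∣p∪q∣≤∣p∣+∣q∣ p q)) (≤-reflexive (sym (+-suc ∣ p ∣ ∣ q ∣)))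
∣p∪q∣≤∣p∣+∣q∣ (false ∷ p) (false ∷ q) = ∣p∪q∣≤∣p∣+∣q∣ p q

module _ {n : ℕ} where

  ∣q∣<∣p∣⇒∃∈p∉q : ∀ {p q : Subset n} → ∣ q ∣ < ∣ p ∣ → ∃ λ x → x ∈ p × x ∉ q
  ∣q∣<∣p∣⇒∃∈p∉q {p} {q} ∣q∣<∣p∣ with any? (λ x → x ∈? p ×-dec ¬? (x ∈? q))
  ... | yes found = found
  ... | no none   = contradiction (p⊆q⇒∣p∣≤∣q∣ p⊆q) (<⇒≱ ∣q∣<∣p∣)
    where
    p⊆q : p ⊆ q
    p⊆q {x} x∈p = decidable-stable (x ∈? q) (λ x∉q → none (x , x∈p , x∉q))

  x∉p⇒∣p∣<∣⁅x⁆∪p∣ : ∀ {x} {p : Subset n} → x ∉ p → ∣ p ∣ < ∣ ⁅ x ⁆ ∪ p ∣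
  x∉p⇒∣p∣<∣⁅x⁆∪p∣ {x} {p} x∉p = p⊂q⇒∣p∣<∣q∣ (q⊆p∪q ⁅ x ⁆ p , x , x∈p∪q⁺ (inj₁ (x∈⁅x⁆ x)) , x∉p)

  ∈⁅x⁆∪⁅y⁆⁻ : ∀ {x y w : Fin n} → w ∈ ⁅ x ⁆ ∪ ⁅ y ⁆ → w ≡ x ⊎ w ≡ y
  ∈⁅x⁆∪⁅y⁆⁻ {x} {y} w∈ with x∈p∪q⁻ ⁅ x ⁆ ⁅ y ⁆ w∈
  ... | inj₁ w∈⁅x⁆ = inj₁ (x∈⁅y⁆⇒x≡y x w∈⁅x⁆)
  ... | inj₂ w∈⁅y⁆ = inj₂ (x∈⁅y⁆⇒x≡y y w∈⁅y⁆)

  ∈⁅x⁆∪⁅y⁆∪⁅z⁆⁻ : ∀ {x y z w : Fin n} → w ∈ ⁅ x ⁆ ∪ ⁅ y ⁆ ∪ ⁅ z ⁆ → w ≡ x ⊎ w ≡ y ⊎ w ≡ z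
  ∈⁅x⁆∪⁅y⁆∪⁅z⁆⁻ {x} {y} {z} w∈ with x∈p∪q⁻ ⁅ x ⁆ (⁅ y ⁆ ∪ ⁅ z ⁆) w∈
  ... | inj₁ w∈⁅x⁆      = inj₁ (x∈⁅y⁆⇒x≡y x w∈⁅x⁆)
  ... | inj₂ w∈⁅y⁆∪⁅z⁆ = inj₂ (∈⁅x⁆∪⁅y⁆⁻ w∈⁅y⁆∪⁅z⁆)

  ∣⁅x⁆∪⁅y⁆∣≡2 : ∀ {x y : Fin n} → x ≢ y → ∣ ⁅ x ⁆ ∪ ⁅ y ⁆ ∣ ≡ 2
  ∣⁅x⁆∪⁅y⁆∣≡2 {x} {y} x≢y = ≤-antisym
    (≤-trans (∣p∪q∣≤∣p∣+∣q∣ ⁅ x ⁆ ⁅ y ⁆) (≤-reflexive (cong₂ _+_ (∣⁅x⁆∣≡1 x) (∣⁅x⁆∣≡1 y))))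
    (subst (λ k → suc k ≤ ∣ ⁅ x ⁆ ∪ ⁅ y ⁆ ∣) (∣⁅x⁆∣≡1 y) (x∉p⇒∣p∣<∣⁅x⁆∪p∣ (x≢y⇒x∉⁅y⁆ x≢y)))

  3≤∣⁅x⁆∪⁅y⁆∪⁅z⁆∣ : ∀ {x y z : Fin n} → x ≢ y → x ≢ z → y ≢ z → 3 ≤ ∣ ⁅ x ⁆ ∪ ⁅ y ⁆ ∪ ⁅ z ⁆ ∣
  3≤∣⁅x⁆∪⁅y⁆∪⁅z⁆∣ {x} {y} {z} x≢y x≢z y≢z =
    subst (λ k → suc k ≤ ∣ ⁅ x ⁆ ∪ ⁅ y ⁆ ∪ ⁅ z ⁆ ∣) (∣⁅x⁆∪⁅y⁆∣≡2 y≢z) (x∉p⇒∣p∣<∣⁅x⁆∪p∣ x∉⁅y⁆∪⁅z⁆)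
    where
    x∉⁅y⁆∪⁅z⁆ : x ∉ ⁅ y ⁆ ∪ ⁅ z ⁆
    x∉⁅y⁆∪⁅z⁆ x∈ with ∈⁅x⁆∪⁅y⁆⁻ x∈
    ... | inj₁ x≡y = x≢y x≡y
    ... | inj₂ x≡z = x≢z x≡z

  two-distinct-members : ∀ {p : Subset n} → 1 < ∣ p ∣ → ∃₂ λ x y → x ∈ p × y ∈ p × x ≢ y
  two-distinct-members {p} 1<∣p∣
    with ∣q∣<∣p∣⇒∃∈p∉q {p} {∅} (subst (_< ∣ p ∣) (sym (∣⊥∣≡0 n)) (<-trans z<s 1<∣p∣))
  ... | x , x∈p , _ with ∣q∣<∣p∣⇒∃∈p∉q {p} {⁅ x ⁆} (subst (_< ∣ p ∣) (sym (∣⁅x⁆∣≡1 x)) 1<∣p∣)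
  ...   | y , y∈p , y∉⁅x⁆ = x , y , x∈p , y∈p , λ x≡y → y∉⁅x⁆ (subst (_∈ ⁅ x ⁆) x≡y (x∈⁅x⁆ x))

  three-distinct-members : ∀ {p : Subset n} → 2 < ∣ p ∣ →
    ∃ λ x → ∃₂ λ y z → x ∈ p × y ∈ p × z ∈ p × x ≢ y × x ≢ z × y ≢ z
  three-distinct-members {p} 2<∣p∣ with two-distinct-members {p} (<-trans (s<s z<s) 2<∣p∣)
  ... | x , y , x∈p , y∈p , x≢y
    with ∣q∣<∣p∣⇒∃∈p∉q {p} {⁅ x ⁆ ∪ ⁅ y ⁆} (subst (_< ∣ p ∣) (sym (∣⁅x⁆∪⁅y⁆∣≡2 x≢y)) 2<∣p∣)
  ...   | z , z∈p , z∉⁅x⁆∪⁅y⁆ = x , y , z , x∈p , y∈p , z∈p , x≢y ,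
          (λ x≡z → z∉⁅x⁆∪⁅y⁆ (subst (_∈ ⁅ x ⁆ ∪ ⁅ y ⁆) x≡z (x∈p∪q⁺ (inj₁ (x∈⁅x⁆ x))))) ,
          (λ y≡z → z∉⁅x⁆∪⁅y⁆ (subst (_∈ ⁅ x ⁆ ∪ ⁅ y ⁆) y≡z (x∈p∪q⁺ (inj₂ (x∈⁅x⁆ y)))))

-- Powers in a finite group

module Powers (G : FiniteGroup) where
  open FiniteGroup G

  group : Group 0ℓ 0ℓ
  group = record
    { Carrier = Elt ; _≈_ = _≡_ ; _∙_ = _∙_ ; ε = e ; _⁻¹ = inv
    ; isGroup = record
      { isMonoid = record
        { isSemigroup = record
          { isMagma = record { isEquivalence = isEquivalence ; ∙-cong = cong₂ _∙_ }
          ; assoc   = assoc }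
        ; identity = identityˡ , identityʳ }
      ; inverse = inverseˡ , inverseʳ
      ; ⁻¹-cong = cong inv } }

  open GroupProperties group using (∙-cancelˡ; inverseʳ-unique; \\-leftDividesʳ; //-rightDividesʳ)

  pow-+ : ∀ x i j → pow x (i + j) ≡ pow x i ∙ pow x j
  pow-+ x zero    j = sym (identityˡ _)
  pow-+ x (suc i) j = trans (cong (x ∙_) (pow-+ x i j)) (sym (assoc _ _ _))

  pow-* : ∀ x i j → pow (pow x i) j ≡ pow x (i * j)
  pow-* x i zero    = cong (pow x) (sym (*-zeroʳ i))
  pow-* x i (suc j) = trans (cong (pow x i ∙_) (pow-* x i j))
                        (trans (sym (pow-+ x i (i * j))) (cong (pow x) (sym (*-suc i j))))

  pow-e : ∀ k → pow e k ≡ e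
  pow-e zero    = refl
  pow-e (suc k) = trans (cong (e ∙_) (pow-e k)) (identityˡ e)

  pow-cancel : ∀ x i d → pow x i ≡ pow x (i + d) → pow x d ≡ e
  pow-cancel x i d xⁱ≡xⁱ⁺ᵈ = sym (∙-cancelˡ (pow x i) e (pow x d)
    (trans (identityʳ _) (trans xⁱ≡xⁱ⁺ᵈ (pow-+ x i d))))

  period : ∀ x → ∃ λ k → pow x (suc k) ≡ e
  period x with pigeonhole (n<1+n order) (λ (i : Fin (suc order)) → pow x (toℕ i))
  ... | i , j , i<j , xⁱ≡xʲ with m≤n⇒∃[o]m+o≡n i<j
  ...   | k , i+1+k≡j = k , pow-cancel x (toℕ i) (suc k)
            (trans xⁱ≡xʲ (cong (pow x) (trans (sym i+1+k≡j) (sym (+-suc (toℕ i) k)))))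

  pow-% : ∀ x N .{{_ : NonZero N}} → pow x N ≡ e → ∀ k → pow x k ≡ pow x (k % N)
  pow-% x N xᴺ≡e k = begin
    pow x k                               ≡⟨ cong (pow x) (m≡m%n+[m/n]*n k N) ⟩
    pow x (k % N + k / N * N)             ≡⟨ pow-+ x (k % N) (k / N * N) ⟩
    pow x (k % N) ∙ pow x (k / N * N)     ≡⟨ cong (λ t → pow x (k % N) ∙ pow x t) (*-comm (k / N) N) ⟩
    pow x (k % N) ∙ pow x (N * (k / N))   ≡⟨ cong (pow x (k % N) ∙_) (pow-* x N (k / N)) ⟨
    pow x (k % N) ∙ pow (pow x N) (k / N) ≡⟨ cong (λ t → pow x (k % N) ∙ pow t (k / N)) xᴺ≡e ⟩
    pow x (k % N) ∙ pow e (k / N)         ≡⟨ cong (pow x (k % N) ∙_) (pow-e (k / N)) ⟩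
    pow x (k % N) ∙ e                     ≡⟨ identityʳ _ ⟩
    pow x (k % N)                         ∎
    where open ≡-Reasoning

  IsPowerOf? : ∀ y x → Dec (IsPowerOf y x)
  IsPowerOf? y x with period x
  ... | n , xⁿ⁺¹≡e with anyUpTo? (λ k → pow x k ≟ᶠ y) (suc n)
  ...   | yes (k , _ , xᵏ≡y) = yes (k , xᵏ≡y)
  ...   | no none = no λ (k , xᵏ≡y) →
            none (k % suc n , m%n<n k (suc n) , trans (sym (pow-% x (suc n) xⁿ⁺¹≡e k)) xᵏ≡y)

  IsPowerOf-refl : ∀ {x} → IsPowerOf x x
  IsPowerOf-refl {x} = 1 , identityʳ x

  IsPowerOf-trans : ∀ {z y x} → IsPowerOf z y → IsPowerOf y x → IsPowerOf z x
  IsPowerOf-trans {x = x} (k , yᵏ≡z) (j , xʲ≡y) =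
    j * k , trans (sym (pow-* x j k)) (trans (cong (λ t → pow t k) xʲ≡y) yᵏ≡z)

  IsPowerOf-inv : ∀ x → IsPowerOf (inv x) x
  IsPowerOf-inv x with period x
  ... | k , xᵏ⁺¹≡e = k , inverseʳ-unique x (pow x k) xᵏ⁺¹≡e

  IsPowerOf-∙ : ∀ {y z x} → IsPowerOf y x → IsPowerOf z x → IsPowerOf (y ∙ z) x
  IsPowerOf-∙ {x = x} (i , xⁱ≡y) (j , xʲ≡z) = i + j , trans (pow-+ x i j) (cong₂ _∙_ xⁱ≡y xʲ≡z)

  IsPowerOf-cancelˡ : ∀ {a b} → IsPowerOf (a ∙ b) a → IsPowerOf b a
  IsPowerOf-cancelˡ {a} {b} ab≼a =
    subst (λ t → IsPowerOf t a) (\\-leftDividesʳ a b) (IsPowerOf-∙ (IsPowerOf-inv a) ab≼a)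

  IsPowerOf-cancelʳ : ∀ {a b} → IsPowerOf (a ∙ b) b → IsPowerOf a b
  IsPowerOf-cancelʳ {a} {b} ab≼b =
    subst (λ t → IsPowerOf t b) (//-rightDividesʳ b a) (IsPowerOf-∙ ab≼b (IsPowerOf-inv b))

  ¬Antichain₃⇒cyclic : ¬ Antichain₃ IsPowerOf U → ∃ λ g → ∀ x → IsPowerOf x g
  ¬Antichain₃⇒cyclic no-antichain with below-maximal IsPowerOf-refl IsPowerOf-trans IsPowerOf? e
  ... | a , _ , a-max with all? (λ x → IsPowerOf? x a)
  ...   | yes a-generates = a , a-generates
  ...   | no ¬a-generates with ¬∀⟶∃¬ order _ (λ x → IsPowerOf? x a) ¬a-generates
  ...     | y , y⋠a with below-maximal IsPowerOf-refl IsPowerOf-trans IsPowerOf? y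
  ...       | b , y≼b , b-max = ⊥-elim (no-antichain (a , b , a ∙ b , tt , tt , tt ,
      incomparable a-max b⋠a ,
      incomparable a-max (λ ab≼a → b⋠a (IsPowerOf-cancelˡ ab≼a)) ,
      incomparable b-max (λ ab≼b → b⋠a (a-max (IsPowerOf-cancelʳ ab≼b)))))
    where
    b⋠a : ¬ IsPowerOf b a
    b⋠a b≼a = y⋠a (IsPowerOf-trans y≼b b≼a)
    incomparable : ∀ {c d} → Maximal IsPowerOf c → ¬ IsPowerOf d c → Incomparable IsPowerOf c d
    incomparable = maximal-Incomparable {_≼_ = IsPowerOf}

module IndependenceNumber (G : FiniteGroup) where
  open FiniteGroup G
  open Powers G

  Incomparable⇒≢ : ∀ {x y} → Incomparable IsPowerOf x y → x ≢ y
  Incomparable⇒≢ (x⋠y , _) refl = x⋠y IsPowerOf-refl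

  Independent⇒Incomparable : ∀ {S x y} → Independent S → x ∈ S → y ∈ S → x ≢ y → Incomparable IsPowerOf x y
  Independent⇒Incomparable S-ind x∈S y∈S x≢y =
    (λ x≼y → S-ind _ _ x∈S y∈S (x≢y , inj₂ x≼y)) , (λ y≼x → S-ind _ _ x∈S y∈S (x≢y , inj₁ y≼x))

  Incomparable⇒Independent : ∀ {S} → (∀ {x y} → x ∈ S → y ∈ S → x ≢ y → Incomparable IsPowerOf x y) →
                             Independent S
  Incomparable⇒Independent incomparable x y x∈S y∈S (x≢y , y≼x⊎x≼y) with incomparable x∈S y∈S x≢y | y≼x⊎x≼y
  ... | _ , y⋠x | inj₁ y≼x = y⋠x y≼x
  ... | x⋠y , _ | inj₂ x≼y = x⋠y x≼y

  pair-Independent : ∀ {x y} → Incomparable IsPowerOf x y → Independent (⁅ x ⁆ ∪ ⁅ y ⁆)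
  pair-Independent {x} {y} x∥y = Incomparable⇒Independent λ u∈ v∈ → members (∈⁅x⁆∪⁅y⁆⁻ u∈) (∈⁅x⁆∪⁅y⁆⁻ v∈)
    where
    members : ∀ {u v} → u ≡ x ⊎ u ≡ y → v ≡ x ⊎ v ≡ y → u ≢ v → Incomparable IsPowerOf u v
    members (inj₁ refl) (inj₁ refl) u≢v = ⊥-elim (u≢v refl)
    members (inj₁ refl) (inj₂ refl) _   = x∥y
    members (inj₂ refl) (inj₁ refl) _   = Incomparable-sym {_≼_ = IsPowerOf} x∥y
    members (inj₂ refl) (inj₂ refl) u≢v = ⊥-elim (u≢v refl)

  triple-Independent : ∀ {x y z} → Incomparable₃ IsPowerOf x y z → Independent (⁅ x ⁆ ∪ ⁅ y ⁆ ∪ ⁅ z ⁆)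
  triple-Independent {x} {y} {z} (x∥y , x∥z , y∥z) =
    Incomparable⇒Independent λ u∈ v∈ → members (∈⁅x⁆∪⁅y⁆∪⁅z⁆⁻ u∈) (∈⁅x⁆∪⁅y⁆∪⁅z⁆⁻ v∈)
    where
    members : ∀ {u v} → u ≡ x ⊎ u ≡ y ⊎ u ≡ z → v ≡ x ⊎ v ≡ y ⊎ v ≡ z → u ≢ v → Incomparable IsPowerOf u v
    members (inj₁ refl)        (inj₁ refl)        u≢v = ⊥-elim (u≢v refl)
    members (inj₁ refl)        (inj₂ (inj₁ refl)) _   = x∥y
    members (inj₁ refl)        (inj₂ (inj₂ refl)) _   = x∥z
    members (inj₂ (inj₁ refl)) (inj₁ refl)        _   = Incomparable-sym {_≼_ = IsPowerOf} x∥y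
    members (inj₂ (inj₁ refl)) (inj₂ (inj₁ refl)) u≢v = ⊥-elim (u≢v refl)
    members (inj₂ (inj₁ refl)) (inj₂ (inj₂ refl)) _   = y∥z
    members (inj₂ (inj₂ refl)) (inj₁ refl)        _   = Incomparable-sym {_≼_ = IsPowerOf} x∥z
    members (inj₂ (inj₂ refl)) (inj₂ (inj₁ refl)) _   = Incomparable-sym {_≼_ = IsPowerOf} y∥z
    members (inj₂ (inj₂ refl)) (inj₂ (inj₂ refl)) u≢v = ⊥-elim (u≢v refl)

  Antichain₂⇒independent-pair : Antichain₂ IsPowerOf U → ∃ λ S → Independent S × ∣ S ∣ ≡ 2
  Antichain₂⇒independent-pair (x , y , _ , _ , x∥y) =
    ⁅ x ⁆ ∪ ⁅ y ⁆ , pair-Independent x∥y , ∣⁅x⁆∪⁅y⁆∣≡2 (Incomparable⇒≢ x∥y)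

  Antichain₃⇒independent-triple : Antichain₃ IsPowerOf U → ∃ λ S → Independent S × 3 ≤ ∣ S ∣
  Antichain₃⇒independent-triple (x , y , z , _ , _ , _ , x∥y , x∥z , y∥z) =
    ⁅ x ⁆ ∪ ⁅ y ⁆ ∪ ⁅ z ⁆ , triple-Independent (x∥y , x∥z , y∥z) ,
    3≤∣⁅x⁆∪⁅y⁆∪⁅z⁆∣ (Incomparable⇒≢ x∥y) (Incomparable⇒≢ x∥z) (Incomparable⇒≢ y∥z)

  independent-pair⇒Antichain₂ : ∀ {S} → Independent S → 1 < ∣ S ∣ → Antichain₂ IsPowerOf U
  independent-pair⇒Antichain₂ {S} S-ind 1<∣S∣ with two-distinct-members {p = S} 1<∣S∣
  ... | x , y , x∈S , y∈S , x≢y = x , y , tt , tt , Independent⇒Incomparable S-ind x∈S y∈S x≢y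

  independent-triple⇒Antichain₃ : ∀ {S} → Independent S → 2 < ∣ S ∣ → Antichain₃ IsPowerOf U
  independent-triple⇒Antichain₃ {S} S-ind 2<∣S∣ with three-distinct-members {p = S} 2<∣S∣
  ... | x , y , z , x∈S , y∈S , z∈S , x≢y , x≢z , y≢z = x , y , z , tt , tt , tt ,
    Independent⇒Incomparable S-ind x∈S y∈S x≢y , Independent⇒Incomparable S-ind x∈S z∈S x≢z ,
    Independent⇒Incomparable S-ind y∈S z∈S y≢z

  IndependenceNumber≡2⇔ : IndependenceNumber≡ 2 ⇔ (Antichain₂ IsPowerOf U × ¬ Antichain₃ IsPowerOf U)
  IndependenceNumber≡2⇔ = mk⇔
    (λ ((S , S-ind , ∣S∣≡2) , bound) →
      independent-pair⇒Antichain₂ S-ind (subst (1 <_) (sym ∣S∣≡2) ≤-refl) ,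
      λ antichain → let (T , T-ind , 3≤∣T∣) = Antichain₃⇒independent-triple antichain
                    in <⇒≱ 3≤∣T∣ (bound T T-ind))
    (λ (antichain , no-antichain) →
      Antichain₂⇒independent-pair antichain ,
      λ T T-ind → ≮⇒≥ λ 2<∣T∣ → no-antichain (independent-triple⇒Antichain₃ T-ind 2<∣T∣))

-- Cyclic groups

toℕ-+ₘ : ∀ {m} .{{_ : NonZero m}} (i j : Fin m) → toℕ (i +ₘ j) ≡ (toℕ i + toℕ j) % m
toℕ-+ₘ {suc m} i j = toℕ-fromℕ< _

module Cyclic (G : FiniteGroup) (g : FiniteGroup.Elt G)
              (generates : ∀ x → FiniteGroup.IsPowerOf G x g) where
  open FiniteGroup G
  open Powers G

  private
    order-of-g : ∃ λ n → pow g (suc n) ≡ e × (∀ {k} → k < n → pow g (suc k) ≢ e)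
    order-of-g = least-witness (λ k → pow g (suc k) ≟ᶠ e) {proj₁ (period g)} (proj₂ (period g))

  N : ℕ
  N = suc (proj₁ order-of-g)

  gᴺ≡e : pow g N ≡ e
  gᴺ≡e = proj₁ (proj₂ order-of-g)

  ψ : Fin N → Elt
  ψ i = pow g (toℕ i)

  ψ-injective : ∀ {i j} → ψ i ≡ ψ j → i ≡ j
  ψ-injective {i} {j} gⁱ≡gʲ = toℕ-injective (pow-injective (toℕ<n i) (toℕ<n j) gⁱ≡gʲ)
    where
    no-repeat : ∀ {a b} → a < b → b < N → pow g a ≢ pow g b
    no-repeat {a} a<b b<N gᵃ≡gᵇ with m≤n⇒∃[o]m+o≡n a<b
    ... | d , a+1+d≡b = proj₂ (proj₂ order-of-g)
      (≤-<-trans (m≤n+m d a) (subst (_≤ _) (sym a+1+d≡b) (s≤s⁻¹ b<N)))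
      (pow-cancel g a (suc d) (trans gᵃ≡gᵇ (cong (pow g) (trans (sym a+1+d≡b) (sym (+-suc a d))))))
    pow-injective : ∀ {a b} → a < N → b < N → pow g a ≡ pow g b → a ≡ b
    pow-injective {a} {b} a<N b<N gᵃ≡gᵇ with <-cmp a b
    ... | tri< a<b _ _ = ⊥-elim (no-repeat a<b b<N gᵃ≡gᵇ)
    ... | tri≈ _ a≡b _ = a≡b
    ... | tri> _ _ b<a = ⊥-elim (no-repeat b<a a<N (sym gᵃ≡gᵇ))

  ψ-+ₘ : ∀ i j → ψ (i +ₘ j) ≡ ψ i ∙ ψ j
  ψ-+ₘ i j = begin
    pow g (toℕ (i +ₘ j))         ≡⟨ cong (pow g) (toℕ-+ₘ i j) ⟩
    pow g ((toℕ i + toℕ j) % N)  ≡⟨ pow-% g N gᴺ≡e (toℕ i + toℕ j) ⟨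
    pow g (toℕ i + toℕ j)        ≡⟨ pow-+ g (toℕ i) (toℕ j) ⟩
    ψ i ∙ ψ j                    ∎
    where open ≡-Reasoning

  log : Elt → Fin N
  log x = proj₁ (generates x) mod N

  ψ-log : ∀ x → ψ (log x) ≡ x
  ψ-log x = begin
    pow g (toℕ (k mod N))  ≡⟨ cong (pow g) (toℕ-fromℕ< (m%n<n k N)) ⟩
    pow g (k % N)          ≡⟨ pow-% g N gᴺ≡e k ⟨
    pow g k                ≡⟨ proj₂ (generates x) ⟩
    x                      ∎
    where
    open ≡-Reasoning
    k = proj₁ (generates x)

  log-injective : ∀ {x y} → log x ≡ log y → x ≡ y
  log-injective {x} {y} logx≡logy = trans (sym (ψ-log x)) (trans (cong ψ logx≡logy) (ψ-log y))

  log-ψ : ∀ i → log (ψ i) ≡ i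
  log-ψ i = ψ-injective (ψ-log (ψ i))

  log-∙ : ∀ x y → log (x ∙ y) ≡ log x +ₘ log y
  log-∙ x y = ψ-injective (begin
    ψ (log (x ∙ y))        ≡⟨ ψ-log (x ∙ y) ⟩
    x ∙ y                  ≡⟨ cong₂ _∙_ (ψ-log x) (ψ-log y) ⟨
    ψ (log x) ∙ ψ (log y)  ≡⟨ ψ-+ₘ (log x) (log y) ⟨
    ψ (log x +ₘ log y)     ∎)
    where open ≡-Reasoning

  isoToCyclic : IsoToCyclic G N
  isoToCyclic = log , (log-injective , λ i → ψ i , λ x≡ψi → trans (cong log x≡ψi) (log-ψ i)) , log-∙

module Levels (G : FiniteGroup) {m : ℕ} (iso : IsoToCyclic G m) where
  open FiniteGroup G
  open Powers G

  f : Elt → Fin m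
  f = proj₁ iso

  f-injective : ∀ {x y} → f x ≡ f y → x ≡ y
  f-injective = proj₁ (proj₁ (proj₂ iso))

  f-surjective : ∀ i → ∃ λ x → f x ≡ i
  f-surjective i = let (x , fx≡i) = proj₂ (proj₁ (proj₂ iso)) i in x , fx≡i refl

  instance
    m-nonZero : NonZero m
    m-nonZero = nonZeroIndex (f e)

  index : Elt → ℕ
  index x = toℕ (f x)

  index-∙ : ∀ x y → index (x ∙ y) ≡ (index x + index y) % m
  index-∙ x y = trans (cong toℕ (proj₂ (proj₂ iso) x y)) (toℕ-+ₘ (f x) (f y))

  index-surjective : ∀ k → ∃ λ x → index x ≡ k % m
  index-surjective k = let (x , fx≡k%m) = f-surjective (k mod m) in
    x , trans (cong toℕ fx≡k%m) (toℕ-fromℕ< (m%n<n k m))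

  index-e : index e ≡ 0
  index-e = let (z , iz≡0) = index-surjective 0 in begin
    index e                  ≡⟨ m<n⇒m%n≡m (toℕ<n (f e)) ⟨
    (0 + index e) % m        ≡⟨ cong (λ t → (t + index e) % m) (trans iz≡0 (m*n%n≡0 0 m)) ⟨
    (index z + index e) % m  ≡⟨ index-∙ z e ⟨
    index (z ∙ e)            ≡⟨ cong index (identityʳ z) ⟩
    index z                  ≡⟨ trans iz≡0 (m*n%n≡0 0 m) ⟩
    0                        ∎
    where open ≡-Reasoning

  index-pow : ∀ x k → index (pow x k) ≡ (k * index x) % m
  index-pow x zero    = trans index-e (sym (m*n%n≡0 0 m))
  index-pow x (suc k) = begin
    index (x ∙ pow x k)                ≡⟨ index-∙ x (pow x k) ⟩
    (index x + index (pow x k)) % m    ≡⟨ cong (λ t → (index x + t) % m) (index-pow x k) ⟩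
    (index x + (k * index x) % m) % m  ≡⟨ [m+[n%d]]%d≡[m+n]%d (index x) (k * index x) m ⟩
    (index x + k * index x) % m        ∎
    where open ≡-Reasoning

  level : Elt → ℕ
  level x = gcd (index x) m

  level∣m : ∀ x → level x ∣ m
  level∣m x = gcd[m,n]∣n (index x) m

  IsPowerOf⇔level∣level : ∀ {x y} → IsPowerOf y x ⇔ level x ∣ level y
  IsPowerOf⇔level∣level {x} {y} = mk⇔
    (λ (k , xᵏ≡y) → gcd-greatest (to (k , trans (sym (index-pow x k)) (cong index xᵏ≡y))) (level∣m x))
    (λ lx∣ly → let (k , kx%m≡y) = from (∣-trans lx∣ly (gcd[m,n]∣m (index y) m))
               in k , f-injective (toℕ-injective (trans (index-pow x k) kx%m≡y)))
    where open Equivalence (multiple-mod⇔gcd∣ {index x} {index y} (toℕ<n (f y)))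

  level-surjective : ∀ {d} → d ∣ m → ∃ λ x → level x ≡ d
  level-surjective {d} d∣m = let (x , ix≡d%m) = index-surjective d in
    x , trans (cong (λ t → gcd t m) ix≡d%m) (gcd[d%m,m]≡d d∣m)

  Incomparable⇔level : ∀ {x y} → Incomparable IsPowerOf x y ⇔ Incomparable _∣_ (level x) (level y)
  Incomparable⇔level {x} {y} = mk⇔
    (λ (x⋠y , y⋠x) → (λ lx∣ly → y⋠x (from y≼x⇔ lx∣ly)) , (λ ly∣lx → x⋠y (from x≼y⇔ ly∣lx)))
    (λ (lx∤ly , ly∤lx) → (λ x≼y → ly∤lx (to x≼y⇔ x≼y)) , (λ y≼x → lx∤ly (to y≼x⇔ y≼x)))
    where
    open Equivalence
    x≼y⇔ : IsPowerOf x y ⇔ level y ∣ level x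
    x≼y⇔ = IsPowerOf⇔level∣level
    y≼x⇔ : IsPowerOf y x ⇔ level x ∣ level y
    y≼x⇔ = IsPowerOf⇔level∣level

  Antichain₂⇔divisors : Antichain₂ IsPowerOf U ⇔ Antichain₂ _∣_ (_∣ m)
  Antichain₂⇔divisors = mk⇔
    (λ (x , y , _ , _ , x∥y) → level x , level y , level∣m x , level∣m y , to Incomparable⇔level x∥y)
    realise
    where
    open Equivalence
    realise : Antichain₂ _∣_ (_∣ m) → Antichain₂ IsPowerOf U
    realise (_ , _ , d∣m , d'∣m , d∥d') with level-surjective d∣m | level-surjective d'∣m
    ... | x , refl | y , refl = x , y , tt , tt , from Incomparable⇔level d∥d'

  Antichain₃⇔divisors : Antichain₃ IsPowerOf U ⇔ Antichain₃ _∣_ (_∣ m)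
  Antichain₃⇔divisors = mk⇔
    (λ (x , y , z , _ , _ , _ , x∥y , x∥z , y∥z) →
      level x , level y , level z , level∣m x , level∣m y , level∣m z ,
      to Incomparable⇔level x∥y , to Incomparable⇔level x∥z , to Incomparable⇔level y∥z)
    realise
    where
    open Equivalence
    realise : Antichain₃ _∣_ (_∣ m) → Antichain₃ IsPowerOf U
    realise (_ , _ , _ , d∣m , d'∣m , d''∣m , d∥d' , d∥d'' , d'∥d'')
      with level-surjective d∣m | level-surjective d'∣m | level-surjective d''∣m
    ... | x , refl | y , refl | z , refl = x , y , z , tt , tt , tt ,
      from Incomparable⇔level d∥d' , from Incomparable⇔level d∥d'' , from Incomparable⇔level d'∥d''

proposition2p7 : (G : FiniteGroup) →
    FiniteGroup.IndependenceNumber≡ G 2 ⇔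
      (∃ λ p → ∃ λ q → ∃ λ n →
        Prime p × Prime q × p ≢ q × 1 ≤ n × IsoToCyclic G (p * q ^ n))
proposition2p7 G = mk⇔ α≡2⇒cyclic-pqⁿ cyclic-pqⁿ⇒α≡2
  where
  open FiniteGroup G
  open Powers G
  open IndependenceNumber G
  open Equivalence

  α≡2⇒cyclic-pqⁿ : IndependenceNumber≡ 2 → ∃ λ p → ∃ λ q → ∃ λ n →
                    Prime p × Prime q × p ≢ q × 1 ≤ n × IsoToCyclic G (p * q ^ n)
  α≡2⇒cyclic-pqⁿ α≡2 =
    let (antichain , no-antichain) = to IndependenceNumber≡2⇔ α≡2
        (g , generates) = ¬Antichain₃⇒cyclic no-antichain
        open Cyclic G g generates
        open Levels G isoToCyclic
        (p , q , n , pp , pq , p≢q , 1≤n , N≡pqⁿ) = divisor-width-2⇒IsPQⁿ N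
          (to Antichain₂⇔divisors antichain)
          (λ antichain₃ → no-antichain (from Antichain₃⇔divisors antichain₃))
    in p , q , n , pp , pq , p≢q , 1≤n , subst (IsoToCyclic G) N≡pqⁿ isoToCyclic

  cyclic-pqⁿ⇒α≡2 : (∃ λ p → ∃ λ q → ∃ λ n → Prime p × Prime q × p ≢ q × 1 ≤ n × IsoToCyclic G (p * q ^ n)) →
                    IndependenceNumber≡ 2
  cyclic-pqⁿ⇒α≡2 (p , q , n , pp , pq , p≢q , 1≤n , iso) = from IndependenceNumber≡2⇔
    ( from Antichain₂⇔divisors (p*q^n-Antichain₂ pp pq p≢q 1≤n)
    , λ antichain₃ → p*q^n-¬Antichain₃ n pp pq (to Antichain₃⇔divisors antichain₃))
    where open Levels G iso
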